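{- Let $c:[\mathbb{N}]^2\to\{\text{BLUE},\text{RED}\}$. Given any two disjoint finite paths $P_b$ (BLUE) and $P_r$ (RED) and an integer $n$ not on either path, one can, computably in $c$, find a one-step path extension $(\tilde P_b,\tilde P_r)$ of $(P_b,P_r)$ such that $n$ appears on exactly one of the paths $\tilde P_b,\tilde P_r$.
   Context: A BLUE (RED) path is a finite or infinite list of distinct natural numbers in which every two consecutive elements form a BLUE (RED) pair under $c$; empty and one-element lists are paths of either color. For a pair $(P_b,P_r)$ of disjoint finite BLUE and RED paths, a pair $(\tilde P_b,\tilde P_r)$ of a BLUE path and a RED path is a one-step path extension of $(P_b,P_r)$ if exactly one of the following holds: (1) $\tilde P_b$ is $P_b$ with one additional element at the end and $\tilde P_r=P_r$; (2) $\tilde P_r$ is $P_r$ with one additional element at the end and $\tilde P_b=P_b$; (3) $\tilde P_b$ is $P_b$ with its last element $x_b$ removed and $\tilde P_r$ is $P_r$ with $x_b$ and then some integer $x$ appended at the end; (4) $\tilde P_r$ is $P_r$ with its last element $x_r$ removed and $\tilde P_b$ is $P_b$ with $x_r$ and then some integer $x$ appended at the end. -}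

module Defs where

open import Data.Nat using (ℕ; _⊓_; _⊔_)
open import Data.List using (List; []; _∷_; _++_; [_])
open import Data.List.Membership.Propositional using (_∈_; _∉_)
open import Data.List.Relation.Unary.Unique.Propositional using (Unique)
open import Data.Product using (_×_)
open import Data.Unit using (⊤)
open import Relation.Binary.PropositionalEquality using (_≡_)

data Colour : Set where
  BLUE RED : Colour

-- A colouring c : [ℕ]² → {BLUE, RED}.  The colour of the unordered pair {x, y}
-- (x ≠ y) is c (min x y) (max x y); values of c on (x, y) with x ≥ y are irrelevant.
Colouring : Set
Colouring = ℕ → ℕ → Colour

pairColour : Colouring → ℕ → ℕ → Colour
pairColour c x y = c (x ⊓ y) (x ⊔ y)

ConsecColour : Colouring → Colour → List ℕ → Set
ConsecColour c col []           = ⊤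
ConsecColour c col (x ∷ [])     = ⊤
ConsecColour c col (x ∷ y ∷ xs) = (pairColour c x y ≡ col) × ConsecColour c col (y ∷ xs)

IsPath : Colouring → Colour → List ℕ → Set
IsPath c col P = Unique P × ConsecColour c col P

Disjoint : List ℕ → List ℕ → Set
Disjoint P Q = ∀ x → x ∈ P → x ∉ Q

-- (P̃b, P̃r) arises from (Pb, Pr) by one of the four operations (1)-(4).
-- The four cases are mutually exclusive (they change the lengths differently).
data OneStepShape (Pb Pr Pb' Pr' : List ℕ) : Set where
  ext₁ : (x : ℕ) → Pb' ≡ Pb ++ [ x ] → Pr' ≡ Pr → OneStepShape Pb Pr Pb' Pr'
  ext₂ : (x : ℕ) → Pr' ≡ Pr ++ [ x ] → Pb' ≡ Pb → OneStepShape Pb Pr Pb' Pr'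
  ext₃ : (Pb₀ : List ℕ) (xb x : ℕ) → Pb ≡ Pb₀ ++ [ xb ] →
         Pb' ≡ Pb₀ → Pr' ≡ Pr ++ (xb ∷ x ∷ []) → OneStepShape Pb Pr Pb' Pr'
  ext₄ : (Pr₀ : List ℕ) (xr x : ℕ) → Pr ≡ Pr₀ ++ [ xr ] →
         Pr' ≡ Pr₀ → Pb' ≡ Pb ++ (xr ∷ x ∷ []) → OneStepShape Pb Pr Pb' Pr'

OneStepExtension : Colouring → (Pb Pr Pb' Pr' : List ℕ) → Set
OneStepExtension c Pb Pr Pb' Pr' =
  IsPath c BLUE Pb' × IsPath c RED Pr' × OneStepShape Pb Pr Pb' Pr'

-- If n cannot be appended to either path, both paths are non-empty, with last
-- elements xb and xr such that {xb, n} is RED and {xr, n} is BLUE.  Whatever the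
-- colour of {xb, xr}, one of these two last elements can be moved to the end of
-- the other path and be followed there by n.
module Submission where

open import Defs
open import Data.Nat using (ℕ)
open import Data.Nat.Properties using (⊓-comm; ⊔-comm)
open import Data.List using (List; []; _∷_; _++_; [_]; _∷ʳ_; initLast; _∷ʳ′_)
open import Data.List.Properties using (++-assoc)
open import Data.List.Membership.Propositional using (_∈_; _∉_)
open import Data.List.Membership.Propositional.Properties using (∈-++⁺ˡ; ∈-++⁺ʳ; ∈-++⁻)
open import Data.List.Relation.Unary.Any using (here)
open import Data.List.Relation.Unary.All using ([]; _∷_)
open import Data.List.Relation.Unary.AllPairs using ([]; _∷_)
open import Data.List.Relation.Unary.Unique.Propositional using (Unique)
import Data.List.Relation.Unary.All.Properties as All
import Data.List.Relation.Unary.Unique.Propositional.Properties as Unique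
open import Data.Product using (Σ; _×_; _,_)
open import Data.Sum using (_⊎_; inj₁; inj₂)
open import Data.Unit using (tt)
open import Relation.Binary.PropositionalEquality using (_≡_; _≢_; refl; trans; cong₂)

pairColour-comm : ∀ c x y → pairColour c x y ≡ pairColour c y x
pairColour-comm c x y = cong₂ c (⊓-comm x y) (⊔-comm x y)

∈-∷ʳ : ∀ {A : Set} (xs : List A) x → x ∈ xs ∷ʳ x
∈-∷ʳ xs x = ∈-++⁺ʳ xs (here refl)

∉-∷ʳ⁺ : ∀ {A : Set} {y} (xs : List A) x → y ∉ xs → y ≢ x → y ∉ xs ∷ʳ x
∉-∷ʳ⁺ xs x y∉xs y≢x y∈ with ∈-++⁻ xs y∈
... | inj₁ y∈xs     = y∉xs y∈xs
... | inj₂ (here eq) = y≢x eq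

∉-∷ʳ⁻ : ∀ {A : Set} {y} (xs : List A) x → y ∉ xs ∷ʳ x → y ∉ xs
∉-∷ʳ⁻ xs x y∉ y∈xs = y∉ (∈-++⁺ˡ y∈xs)

Unique-∷ʳ⁺ : ∀ {A : Set} {xs : List A} {y} → Unique xs → y ∉ xs → Unique (xs ∷ʳ y)
Unique-∷ʳ⁺ uxs y∉xs =
  Unique.++⁺ uxs ([] ∷ []) λ { (y∈xs , here refl) → y∉xs y∈xs }

Unique-∷ʳ⁻ : ∀ {A : Set} (xs : List A) y → Unique (xs ∷ʳ y) → Unique xs
Unique-∷ʳ⁻ []       y u        = []
Unique-∷ʳ⁻ (x ∷ xs) y (x∉ ∷ u) = All.++⁻ˡ xs x∉ ∷ Unique-∷ʳ⁻ xs y u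

ConsecColour-∷ʳ⁺ : ∀ {c col} xs x y → ConsecColour c col (xs ∷ʳ x) →
                   pairColour c x y ≡ col → ConsecColour c col (xs ∷ʳ x ∷ʳ y)
ConsecColour-∷ʳ⁺ []           x y _         xy = xy , tt
ConsecColour-∷ʳ⁺ (a ∷ [])     x y (ax , _)  xy = ax , xy , tt
ConsecColour-∷ʳ⁺ (a ∷ b ∷ xs) x y (ab , cs) xy = ab , ConsecColour-∷ʳ⁺ (b ∷ xs) x y cs xy

ConsecColour-∷ʳ⁻ : ∀ {c col} xs x → ConsecColour c col (xs ∷ʳ x) → ConsecColour c col xs
ConsecColour-∷ʳ⁻ []           x _         = tt
ConsecColour-∷ʳ⁻ (a ∷ [])     x _         = tt
ConsecColour-∷ʳ⁻ (a ∷ b ∷ xs) x (ab , cs) = ab , ConsecColour-∷ʳ⁻ (b ∷ xs) x cs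

IsPath-singleton : ∀ c col x → IsPath c col [ x ]
IsPath-singleton c col x = [] ∷ [] , tt

IsPath-∷ʳ⁺ : ∀ {c col} xs x y → IsPath c col (xs ∷ʳ x) → y ∉ xs ∷ʳ x →
             pairColour c x y ≡ col → IsPath c col (xs ∷ʳ x ∷ʳ y)
IsPath-∷ʳ⁺ xs x y (u , cs) y∉ xy = Unique-∷ʳ⁺ u y∉ , ConsecColour-∷ʳ⁺ xs x y cs xy

IsPath-∷ʳ⁻ : ∀ {c col} xs x → IsPath c col (xs ∷ʳ x) → IsPath c col xs
IsPath-∷ʳ⁻ xs x (u , cs) = Unique-∷ʳ⁻ xs x u , ConsecColour-∷ʳ⁻ xs x cs

ExtensionCovering : Colouring → (Pb Pr : List ℕ) → ℕ → Set
ExtensionCovering c Pb Pr n =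
  Σ (List ℕ) λ Pb' → Σ (List ℕ) λ Pr' →
    OneStepExtension c Pb Pr Pb' Pr' ×
    ((n ∈ Pb' × n ∉ Pr') ⊎ (n ∉ Pb' × n ∈ Pr'))

appendBlue : ∀ c {Pr n} Pb → IsPath c BLUE (Pb ∷ʳ n) → IsPath c RED Pr → n ∉ Pr →
             ExtensionCovering c Pb Pr n
appendBlue c {n = n} Pb pb pr n∉Pr =
  Pb ∷ʳ n , _ , (pb , pr , ext₁ n refl refl) , inj₁ (∈-∷ʳ Pb n , n∉Pr)

appendRed : ∀ c {Pb n} Pr → IsPath c BLUE Pb → IsPath c RED (Pr ∷ʳ n) → n ∉ Pb →
            ExtensionCovering c Pb Pr n
appendRed c {n = n} Pr pb pr n∉Pb =
  _ , Pr ∷ʳ n , (pb , pr , ext₂ n refl refl) , inj₂ (n∉Pb , ∈-∷ʳ Pr n)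

moveBlueEnd : ∀ c {Pr n} Pb xb → IsPath c BLUE Pb → IsPath c RED (Pr ∷ʳ xb ∷ʳ n) →
              n ∉ Pb → ExtensionCovering c (Pb ∷ʳ xb) Pr n
moveBlueEnd c {Pr = Pr} {n} Pb xb pb pr n∉Pb =
  Pb , Pr ∷ʳ xb ∷ʳ n , (pb , pr , ext₃ Pb xb n refl refl (++-assoc Pr [ xb ] [ n ])) ,
  inj₂ (n∉Pb , ∈-∷ʳ (Pr ∷ʳ xb) n)

moveRedEnd : ∀ c {Pb n} Pr xr → IsPath c BLUE (Pb ∷ʳ xr ∷ʳ n) → IsPath c RED Pr →
             n ∉ Pr → ExtensionCovering c Pb (Pr ∷ʳ xr) n
moveRedEnd c {Pb = Pb} {n} Pr xr pb pr n∉Pr =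
  Pb ∷ʳ xr ∷ʳ n , Pr , (pb , pr , ext₄ Pr xr n refl refl (++-assoc Pb [ xr ] [ n ])) ,
  inj₁ (∈-∷ʳ (Pb ∷ʳ xr) n , n∉Pr)

lemma3 : (c : Colouring) (Pb Pr : List ℕ) →
         IsPath c BLUE Pb → IsPath c RED Pr → Disjoint Pb Pr →
         (n : ℕ) → n ∉ Pb → n ∉ Pr →
         Σ (List ℕ) λ Pb' → Σ (List ℕ) λ Pr' →
           OneStepExtension c Pb Pr Pb' Pr' ×
           ((n ∈ Pb' × n ∉ Pr') ⊎ (n ∉ Pb' × n ∈ Pr'))
lemma3 c Pb Pr pb pr disj n n∉Pb n∉Pr with initLast Pb | initLast Pr
... | []         | _  = appendBlue c [] (IsPath-singleton c BLUE n) pr n∉Pr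
... | ys ∷ʳ′ xb  | [] = appendRed c [] pb (IsPath-singleton c RED n) n∉Pb
... | ys ∷ʳ′ xb  | zs ∷ʳ′ xr
  with pairColour c xb n in xb-n | pairColour c xr n in xr-n | pairColour c xb xr in xb-xr
... | BLUE | _    | _    = appendBlue c Pb (IsPath-∷ʳ⁺ ys xb n pb n∉Pb xb-n) pr n∉Pr
... | RED  | RED  | _    = appendRed c Pr pb (IsPath-∷ʳ⁺ zs xr n pr n∉Pr xr-n) n∉Pb
... | RED  | BLUE | RED  =
  moveBlueEnd c ys xb (IsPath-∷ʳ⁻ ys xb pb) (IsPath-∷ʳ⁺ Pr xb n pr⁺ n∉Pr⁺ xb-n) (∉-∷ʳ⁻ ys xb n∉Pb)
  where
    pr⁺ : IsPath c RED (Pr ∷ʳ xb)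
    pr⁺ = IsPath-∷ʳ⁺ zs xr xb pr (disj xb (∈-∷ʳ ys xb)) (trans (pairColour-comm c xr xb) xb-xr)
    n∉Pr⁺ : n ∉ Pr ∷ʳ xb
    n∉Pr⁺ = ∉-∷ʳ⁺ Pr xb n∉Pr λ { refl → n∉Pb (∈-∷ʳ ys xb) }
... | RED  | BLUE | BLUE =
  moveRedEnd c zs xr (IsPath-∷ʳ⁺ Pb xr n pb⁺ n∉Pb⁺ xr-n) (IsPath-∷ʳ⁻ zs xr pr) (∉-∷ʳ⁻ zs xr n∉Pr)
  where
    pb⁺ : IsPath c BLUE (Pb ∷ʳ xr)
    pb⁺ = IsPath-∷ʳ⁺ ys xb xr pb (λ xr∈Pb → disj xr xr∈Pb (∈-∷ʳ zs xr)) xb-xr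
    n∉Pb⁺ : n ∉ Pb ∷ʳ xr
    n∉Pb⁺ = ∉-∷ʳ⁺ Pb xr n∉Pb λ { refl → n∉Pr (∈-∷ʳ zs xr) }
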